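{- Let $\mathcal{G}$ be a connected graph with vertices $v_1,\dots,v_n$ and let $\alpha,\beta\in\mathbb{Z}^n$ with $\beta\le\alpha$ (toppling dominance). Then there exists a unique $\lambda\in P_n$ such that $T^\lambda(\alpha)=\beta$, and the sequences in $\mathcal{Y}_{\alpha,\beta}$ of minimal length are exactly the toppling sequences associated with standard Young tableaux of shape $\lambda$.
   Context: $\mathcal{G}=(V,E)$ is a connected graph with vertex set $V=\{v_1,\dots,v_n\}$, no loops and at most one edge between any two vertices. $\epsilon_i\in\mathbb{Z}^n$ is the $i$th standard basis vector, $d_i$ the degree of $v_i$, $\Delta_i=\big(\sum_{j:\{v_j,v_i\}\in E}\epsilon_j\big)-d_i\epsilon_i$, and $T_i(\alpha)=\alpha+\Delta_i$ for $\alpha\in\mathbb{Z}^n$. For $a\in\mathbb{Z}^n$, $T^a=T_1^{a_1}\cdots T_n^{a_n}$. Toppling dominance: $\beta\le\alpha$ iff $\beta=T^\lambda(\alpha)$ for some $\lambda\in\mathbb{N}^n$ with $\lambda_1\ge\lambda_2\ge\cdots\ge\lambda_n$. $P_n$ is the set of $\lambda\in\mathbb{N}^n$ with $\lambda_1\ge\cdots\ge\lambda_n=0$ (identified with integer partitions with at most $n-1$ parts). A toppling sequence is a finite sequence $(T_{i_1},\dots,T_{i_l})$ with $i_k\in\{1,\dots,n\}$; it is an $\alpha,\beta$-toppling sequence if $\beta=T_{i_l}\cdots T_{i_1}(\alpha)$. $\mathcal{Y}_{\alpha,\beta}$ is the set of $\alpha,\beta$-toppling sequences such that $\alpha^{(k)}:=T_{i_k}T_{i_{k-1}}\cdots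 T_{i_1}(\alpha)$ satisfies $\alpha^{(k)}\le\alpha$ for all $1\le k\le l$. The toppling sequence associated with a standard Young tableau with $l$ boxes is $(T_{i_1},\dots,T_{i_l})$ where $i_m$ is the index of the row containing the entry $m$ (i.e. $i_1\cdots i_l$ is the Yamanouchi word of the tableau). The shape of a tableau is the partition listing its row lengths, viewed as an element of $\mathbb{N}^n$ by padding with zeros. -}

module Defs where

open import Data.Nat as ℕ using (ℕ; zero; suc)
open import Data.Integer as ℤ using (ℤ; +_)
open import Data.Fin as Fin using (Fin; toℕ; fromℕ)
open import Data.Fin.Properties using (_≟_)
open import Data.Bool using (Bool; true; false; if_then_else_)
open import Data.Vec as Vec using (Vec; lookup; tabulate; allFin)
open import Data.List as List using (List; []; _∷_; length; concat; upTo)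
open import Data.List.Membership.Propositional using (_∈_)
open import Data.List.Relation.Binary.Permutation.Propositional using (_↭_)
open import Data.Maybe using (Maybe; just; nothing)
open import Data.Product using (Σ; ∃; _×_; _,_)
open import Relation.Nullary using (does)
open import Data.Unit using (⊤)
open import Relation.Binary.PropositionalEquality using (_≡_)

-- Simple graphs on the vertex set Fin n (vertex i stands for v_{i+1}).
-- No loops, symmetric adjacency; "at most one edge" is automatic.

record Graph (n : ℕ) : Set where
  field
    adj     : Fin n → Fin n → Bool
    sym     : ∀ i j → adj i j ≡ adj j i
    noLoops : ∀ i → adj i i ≡ false
open Graph public

data Walk {n : ℕ} (G : Graph n) : Fin n → Fin n → Set where
  here : ∀ {i} → Walk G i i
  step : ∀ {i j k} → adj G i j ≡ true → Walk G j k → Walk G i k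

Connected : ∀ {n} → Graph n → Set
Connected G = ∀ i j → Walk G i j

Config : ℕ → Set
Config n = Vec ℤ n

degree : ∀ {n} → Graph n → Fin n → ℕ
degree G i = Vec.sum (Vec.map (λ j → if adj G i j then 1 else 0) (allFin _))

ε : ∀ {n} → Fin n → Vec ℤ n
ε i = tabulate (λ j → if does (j ≟ i) then + 1 else + 0)

Δ : ∀ {n} → Graph n → Fin n → Vec ℤ n
Δ G i = tabulate (λ j → (if adj G j i then + 1 else + 0)
                        ℤ.- (if does (j ≟ i) then + degree G i else + 0))

T : ∀ {n} → Graph n → Fin n → Config n → Config n
T G i α = Vec.zipWith ℤ._+_ α (Δ G i)

iter : ∀ {A : Set} → ℕ → (A → A) → A → A
iter zero    f x = x
iter (suc k) f x = f (iter k f x)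

-- T^a = T_1^{a_1} ∘ ⋯ ∘ T_n^{a_n}
Tpow : ∀ {n} → Graph n → Vec ℕ n → Config n → Config n
Tpow {n} G a = Vec.foldr (λ _ → Config n → Config n)
                 (λ p g → iter (Data.Product.proj₂ p) (T G (Data.Product.proj₁ p)) ∘′ g)
                 (λ x → x) (Vec.zip (allFin n) a)
  where
  _∘′_ : ∀ {A : Set} → (A → A) → (A → A) → A → A
  (f ∘′ g) x = f (g x)

Decreasing : ∀ {n} → Vec ℕ n → Set
Decreasing {n} a = ∀ (i j : Fin n) → toℕ i ℕ.≤ toℕ j → lookup a j ℕ.≤ lookup a i

_≤T[_]_ : ∀ {n} → Config n → Graph n → Config n → Set
_≤T[_]_ {n} β G α = Σ (Vec ℕ n) λ a → Decreasing a × Tpow G a α ≡ β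

InP : ∀ {k} → Vec ℕ (suc k) → Set
InP {k} a = Decreasing a × lookup a (fromℕ k) ≡ 0

-- toppling sequences (lists of vertex indices, applied left to right)

ToppSeq : ℕ → Set
ToppSeq n = List (Fin n)

run : ∀ {n} → Graph n → ToppSeq n → Config n → Config n
run G []       α = α
run G (i ∷ s)  α = run G s (T G i α)

AllBelow : ∀ {n} → Graph n → Config n → ToppSeq n → Config n → Set
AllBelow G α []      γ = ⊤
AllBelow G α (i ∷ s) γ = (T G i γ ≤T[ G ] α) × AllBelow G α s (T G i γ)

InY : ∀ {n} → Graph n → Config n → Config n → ToppSeq n → Set
InY G α β s = run G s α ≡ β × AllBelow G α s α

MinInY : ∀ {n} → Graph n → Config n → Config n → ToppSeq n → Set
MinInY G α β s = InY G α β s × (∀ s' → InY G α β s' → length s ℕ.≤ length s')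

-- standard Young tableaux, given by their rows (row r is a list of entries)

_‼_ : List ℕ → ℕ → Maybe ℕ
[]      ‼ _       = nothing
(x ∷ _) ‼ zero    = just x
(_ ∷ xs) ‼ suc j  = xs ‼ j

-- rows is a standard Young tableau of shape a (a partition, padded by zeros)
IsSYT : ∀ {n} → Vec ℕ n → Vec (List ℕ) n → Set
IsSYT {n} a rows =
    (∀ r → length (lookup rows r) ≡ lookup a r)
  × (∀ r j x y → lookup rows r ‼ j ≡ just x → lookup rows r ‼ suc j ≡ just y → x ℕ.< y)
  × (∀ (r r' : Fin n) → toℕ r' ≡ suc (toℕ r) → ∀ j y → lookup rows r' ‼ j ≡ just y →
       ∃ λ x → lookup rows r ‼ j ≡ just x × x ℕ.< y)
  × (concat (Vec.toList rows) ↭ List.map suc (upTo (Vec.sum a)))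

AssocSeq : ∀ {n} → Vec (List ℕ) n → ToppSeq n → Set
AssocSeq rows s =
  length s ≡ Vec.sum (Vec.map length rows)
  × (∀ (m : Fin (length s)) → suc (toℕ m) ∈ lookup rows (List.lookup s m))

-- Writing T^a(α) = α + Σₚ aₚ Δₚ, the Δₚ are the columns of minus the Laplacian of the graph,
-- whose kernel on a connected graph consists of the constant vectors (discrete maximum principle).
-- So T^a(α) = T^b(α) exactly when a − b is constant: subtracting its last part from a decreasing a
-- gives the unique λ ∈ Pₙ with T^λ(α) = β. A toppling sequence s produces T^c(α), c its content,
-- so s lies in Y_{α,β} iff every prefix of s has decreasing content (s is a Yamanouchi word) and
-- c = λ + k for a constant k. The minimal ones are therefore the Yamanouchi words of content λ
-- (0^λ₁ 1^λ₂ ⋯ is one), and these correspond to the standard Young tableaux of shape λ by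
-- recording in row r the positions at which s topples vertex r.
module Submission where

open import Defs hiding (sym)
open import Data.Nat as ℕ using (ℕ; zero; suc; _≤_; _<_; z≤n; s≤s; _∸_)
import Data.Nat.Properties as ℕP
open import Data.Integer as ℤ using (ℤ; +_; 0ℤ; 1ℤ; -1ℤ; _+_; _*_; _-_; -_)
import Data.Integer.Properties as ℤP
open import Data.Integer.Tactic.RingSolver using (solve-∀)
open import Data.Fin as Fin using (Fin; zero; suc; toℕ; fromℕ)
open import Data.Fin.Properties using (_≟_)
import Data.Fin.Properties as FinP
open import Data.Bool using (true; false; if_then_else_)
open import Data.Vec as Vec using (Vec; []; _∷_; lookup; tabulate)
import Data.Vec.Properties as VecP
open import Data.List as List using (List; []; _∷_; take; length)
import Data.List.Properties as ListP
open import Data.List.Membership.Propositional using (_∈_)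
import Data.List.Membership.Propositional.Properties as ∈P
open import Data.List.Relation.Unary.Any using (here; there)
import Data.List.Relation.Unary.All as All
import Data.List.Relation.Unary.AllPairs as AllPairs
open import Data.List.Relation.Unary.Unique.Propositional using (Unique)
import Data.List.Relation.Unary.Unique.Propositional.Properties as UniqueP
open import Data.List.Relation.Binary.Permutation.Propositional
  using (_↭_; ↭-refl; ↭-reflexive; ↭-trans; ↭-prep; ↭-sym; ↭⇒↭ₛ)
import Data.List.Relation.Binary.Permutation.Propositional.Properties as ↭P
import Data.List.Relation.Binary.Permutation.Setoid.Properties as ↭ₛP
open import Data.Maybe using (just)
open import Data.Product using (Σ; ∃; _×_; _,_; proj₁; proj₂)
open import Data.Sum using (_⊎_; inj₁; inj₂)
open import Data.Unit using (tt)
open import Data.Empty using (⊥; ⊥-elim)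
open import Function using (_∘_; id)
open import Function.Bundles using (_⇔_; mk⇔; Equivalence)
open import Relation.Nullary using (does; yes; no; ¬_; contradiction)
open import Relation.Nullary.Decidable using (dec-true; dec-false)
open import Relation.Binary.PropositionalEquality
open import Algebra.Properties.Ring ℤP.+-*-ring using (x[y-z]≈xy-xz; +-cancelˡ)
open import Algebra.Properties.Semiring.Sum ℤP.+-*-semiring
  using (sum; sum-syntax; sum-cong-≗; ∑-distrib-+; *-distribˡ-sum; sum-replicate-zero)

∑-distrib-- : ∀ {n} (f g : Fin n → ℤ) → ∑[ p < n ] (f p - g p) ≡ sum f - sum g
∑-distrib-- {n} f g = begin
  ∑[ p < n ] (f p + - g p)        ≡⟨ ∑-distrib-+ f (λ p → - g p) ⟩
  sum f + ∑[ p < n ] (- g p)      ≡⟨ cong (_+_ (sum f)) (sum-cong-≗ (λ p → sym (ℤP.-1*i≡-i (g p)))) ⟩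
  sum f + ∑[ p < n ] (-1ℤ * g p)  ≡⟨ cong (_+_ (sum f)) (sym (*-distribˡ-sum -1ℤ g)) ⟩
  sum f + -1ℤ * sum g             ≡⟨ cong (_+_ (sum f)) (ℤP.-1*i≡-i (sum g)) ⟩
  sum f - sum g                   ∎
  where open ≡-Reasoning

∑-single : ∀ {n} (i : Fin n) (f : Fin n → ℤ) → (∀ p → p ≢ i → f p ≡ 0ℤ) → sum f ≡ f i
∑-single {suc n} zero f vanish = begin
  f zero + ∑[ p < n ] f (suc p)   ≡⟨ cong (_+_ (f zero)) (sum-cong-≗ (λ p → vanish (suc p) λ ())) ⟩
  f zero + ∑[ p < n ] 0ℤ          ≡⟨ cong (_+_ (f zero)) (sum-replicate-zero n) ⟩
  f zero + 0ℤ                     ≡⟨ ℤP.+-identityʳ (f zero) ⟩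
  f zero                          ∎
  where open ≡-Reasoning
∑-single {suc n} (suc i) f vanish = begin
  f zero + ∑[ p < n ] f (suc p)
    ≡⟨ cong (_+ ∑[ p < n ] f (suc p)) (vanish zero λ ()) ⟩
  0ℤ + ∑[ p < n ] f (suc p)
    ≡⟨ ℤP.+-identityˡ _ ⟩
  ∑[ p < n ] f (suc p)
    ≡⟨ ∑-single i (f ∘ suc) (λ p p≢i → vanish (suc p) (p≢i ∘ FinP.suc-injective)) ⟩
  f (suc i) ∎
  where open ≡-Reasoning

nonneg-+≡0 : ∀ {i j} → 0ℤ ℤ.≤ i → 0ℤ ℤ.≤ j → i + j ≡ 0ℤ → i ≡ 0ℤ × j ≡ 0ℤ
nonneg-+≡0 (ℤ.+≤+ {n = m} _) (ℤ.+≤+ {n = k} _) m+k≡0 =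
    cong +_ (ℕP.m+n≡0⇒m≡0 m (ℤP.+-injective m+k≡0))
  , cong +_ (ℕP.m+n≡0⇒n≡0 m (ℤP.+-injective m+k≡0))

∑-nonneg : ∀ {n} (f : Fin n → ℤ) → (∀ p → 0ℤ ℤ.≤ f p) → 0ℤ ℤ.≤ sum f
∑-nonneg {zero}  f nonneg = ℤP.≤-refl
∑-nonneg {suc n} f nonneg = ℤP.+-mono-≤ (nonneg zero) (∑-nonneg (f ∘ suc) (nonneg ∘ suc))

∑-nonneg-≡0 : ∀ {n} (f : Fin n → ℤ) → (∀ p → 0ℤ ℤ.≤ f p) → sum f ≡ 0ℤ →
              ∀ p → f p ≡ 0ℤ
∑-nonneg-≡0 {suc n} f nonneg ∑≡0 p
  with f₀≡0 , ∑rest≡0 ← nonneg-+≡0 (nonneg zero) (∑-nonneg (f ∘ suc) (nonneg ∘ suc)) ∑≡0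
  with p
... | zero  = f₀≡0
... | suc q = ∑-nonneg-≡0 (f ∘ suc) (nonneg ∘ suc) ∑rest≡0 q

pos-sum-tabulate : ∀ {m n} (f : Fin n → ℕ) (g : Fin m → Fin n) →
                   + Vec.sum (Vec.map f (tabulate g)) ≡ ∑[ q < m ] (+ f (g q))
pos-sum-tabulate {zero}  f g = refl
pos-sum-tabulate {suc m} f g =
  trans (ℤP.pos-+ (f (g zero)) _) (cong (_+_ (+ f (g zero))) (pos-sum-tabulate f (g ∘ suc)))

i-j≡k-l⇒i+l≡k+j : ∀ i j k l → i - j ≡ k - l → i + l ≡ k + j
i-j≡k-l⇒i+l≡k+j i j k l i-j≡k-l = begin
  i + l             ≡⟨ insert i j l ⟩
  i - j + (j + l)   ≡⟨ cong (_+ (j + l)) i-j≡k-l ⟩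
  k - l + (j + l)   ≡⟨ cancel k l j ⟩
  k + j             ∎
  where
  open ≡-Reasoning
  insert : ∀ a b c → a + c ≡ a - b + (b + c)
  insert = solve-∀
  cancel : ∀ a c b → a - c + (b + c) ≡ a + b
  cancel = solve-∀

-- The Laplacian of a graph

adjℤ : ∀ {n} → Graph n → Fin n → Fin n → ℤ
adjℤ G j p = if adj G j p then 1ℤ else 0ℤ

degree-∑ : ∀ {n} (G : Graph n) j → + degree G j ≡ ∑[ p < n ] adjℤ G j p
degree-∑ G j = trans (pos-sum-tabulate (λ p → if adj G j p then 1 else 0) id) (sum-cong-≗ (pos-if ∘ adj G j))
  where
  pos-if : ∀ b → + (if b then 1 else 0) ≡ (if b then 1ℤ else 0ℤ)
  pos-if true  = refl
  pos-if false = refl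

∑Δ : ∀ {n} → Graph n → (Fin n → ℤ) → Fin n → ℤ
∑Δ {n} G y j = ∑[ p < n ] (y p * lookup (Δ G p) j)

module _ {n : ℕ} (G : Graph n) where

  open ≡-Reasoning

  ∑Δ-expand : ∀ y j → ∑Δ G y j ≡ ∑[ p < n ] (y p * adjℤ G j p) - y j * + degree G j
  ∑Δ-expand y j = begin
    ∑[ p < n ] (y p * lookup (Δ G p) j)
      ≡⟨ sum-cong-≗ (λ p → cong (y p *_) (VecP.lookup∘tabulate _ j)) ⟩
    ∑[ p < n ] (y p * (adjℤ G j p - diag p))
      ≡⟨ sum-cong-≗ (λ p → x[y-z]≈xy-xz (y p) (adjℤ G j p) (diag p)) ⟩
    ∑[ p < n ] (y p * adjℤ G j p - y p * diag p)
      ≡⟨ ∑-distrib-- (λ p → y p * adjℤ G j p) (λ p → y p * diag p) ⟩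
    ∑yA - ∑[ p < n ] (y p * diag p)
      ≡⟨ cong (_-_ ∑yA) (∑-single j (λ p → y p * diag p) off-diagonal) ⟩
    ∑yA - y j * diag j
      ≡⟨ cong (λ b → ∑yA - y j * (if b then + degree G j else 0ℤ)) (dec-true (j ≟ j) refl) ⟩
    ∑yA - y j * + degree G j ∎
    where
    ∑yA : ℤ
    ∑yA = ∑[ p < n ] (y p * adjℤ G j p)
    diag : Fin n → ℤ
    diag p = if does (j ≟ p) then + degree G p else 0ℤ
    off-diagonal : ∀ p → p ≢ j → y p * diag p ≡ 0ℤ
    off-diagonal p p≢j rewrite dec-false (j ≟ p) (p≢j ∘ sym) = ℤP.*-zeroʳ (y p)

  ∑Δ-neighbours : ∀ y j → ∑[ p < n ] (adjℤ G j p * (y j - y p)) ≡ - ∑Δ G y j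
  ∑Δ-neighbours y j = begin
    ∑[ p < n ] (adjℤ G j p * (y j - y p))
      ≡⟨ sum-cong-≗ (λ p → swap (adjℤ G j p) (y j) (y p)) ⟩
    ∑[ p < n ] (y j * adjℤ G j p - y p * adjℤ G j p)
      ≡⟨ ∑-distrib-- (λ p → y j * adjℤ G j p) (λ p → y p * adjℤ G j p) ⟩
    ∑[ p < n ] (y j * adjℤ G j p) - ∑yA
      ≡⟨ cong (_- ∑yA) (sym (*-distribˡ-sum (y j) (adjℤ G j))) ⟩
    y j * ∑[ p < n ] adjℤ G j p - ∑yA
      ≡⟨ cong (λ d → y j * d - ∑yA) (sym (degree-∑ G j)) ⟩
    y j * + degree G j - ∑yA
      ≡⟨ a-b≡-[b-a] (y j * + degree G j) ∑yA ⟩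
    - (∑yA - y j * + degree G j)
      ≡⟨ cong -_ (sym (∑Δ-expand y j)) ⟩
    - ∑Δ G y j ∎
    where
    ∑yA : ℤ
    ∑yA = ∑[ p < n ] (y p * adjℤ G j p)
    swap : ∀ a b c → a * (b - c) ≡ b * a - c * a
    swap = solve-∀
    a-b≡-[b-a] : ∀ a b → a - b ≡ - (b - a)
    a-b≡-[b-a] = solve-∀

  ∑Δ-const : ∀ c j → ∑Δ G (λ _ → c) j ≡ 0ℤ
  ∑Δ-const c j = begin
    ∑Δ G (λ _ → c) j                       ≡⟨ ℤP.neg-involutive _ ⟨
    - - ∑Δ G (λ _ → c) j                   ≡⟨ cong -_ (∑Δ-neighbours (λ _ → c) j) ⟨
    - ∑[ p < n ] (adjℤ G j p * (c - c))    ≡⟨ cong -_ (sum-cong-≗ (vanish ∘ adjℤ G j)) ⟩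
    - ∑[ p < n ] 0ℤ                        ≡⟨ cong -_ (sum-replicate-zero n) ⟩
    0ℤ                                     ∎
    where
    vanish : ∀ a → a * (c - c) ≡ 0ℤ
    vanish a = trans (cong (a *_) (ℤP.+-inverseʳ c)) (ℤP.*-zeroʳ a)

  ∑Δ-cong : ∀ {y z} → (∀ p → y p ≡ z p) → ∀ j → ∑Δ G y j ≡ ∑Δ G z j
  ∑Δ-cong y≗z j = sum-cong-≗ (λ p → cong (_* lookup (Δ G p) j) (y≗z p))

  ∑Δ-+ : ∀ y z j → ∑Δ G (λ p → y p + z p) j ≡ ∑Δ G y j + ∑Δ G z j
  ∑Δ-+ y z j = trans (sum-cong-≗ (λ p → ℤP.*-distribʳ-+ (lookup (Δ G p) j) (y p) (z p)))
                     (∑-distrib-+ (λ p → y p * lookup (Δ G p) j) (λ p → z p * lookup (Δ G p) j))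

  ∑Δ-- : ∀ y z j → ∑Δ G (λ p → y p - z p) j ≡ ∑Δ G y j - ∑Δ G z j
  ∑Δ-- y z j = trans (sum-cong-≗ (λ p → distribʳ-- (y p) (z p) (lookup (Δ G p) j)))
                     (∑-distrib-- (λ p → y p * lookup (Δ G p) j) (λ p → z p * lookup (Δ G p) j))
    where
    distribʳ-- : ∀ a b c → (a - b) * c ≡ a * c - b * c
    distribʳ-- = solve-∀

  ∑Δ-indicator : ∀ i j → ∑Δ G (λ p → if does (i ≟ p) then 1ℤ else 0ℤ) j ≡ lookup (Δ G i) j
  ∑Δ-indicator i j = begin
    ∑Δ G indicator j
      ≡⟨ ∑-single i (λ p → indicator p * lookup (Δ G p) j) off-i ⟩
    indicator i * lookup (Δ G i) j
      ≡⟨ cong (λ b → (if b then 1ℤ else 0ℤ) * lookup (Δ G i) j) (dec-true (i ≟ i) refl) ⟩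
    1ℤ * lookup (Δ G i) j
      ≡⟨ ℤP.*-identityˡ _ ⟩
    lookup (Δ G i) j ∎
    where
    indicator : Fin n → ℤ
    indicator p = if does (i ≟ p) then 1ℤ else 0ℤ
    off-i : ∀ p → p ≢ i → indicator p * lookup (Δ G p) j ≡ 0ℤ
    off-i p p≢i rewrite dec-false (i ≟ p) (p≢i ∘ sym) = refl

-- Harmonic functions on a connected graph

∃-maximum : ∀ {n} (y : Fin (suc n) → ℤ) → ∃ λ j → ∀ p → y p ℤ.≤ y j
∃-maximum {zero}  y = zero , λ { zero → ℤP.≤-refl }
∃-maximum {suc n} y with ∃-maximum (y ∘ suc)
... | j , max with ℤP.≤-total (y zero) (y (suc j))
...   | inj₁ y₀≤yⱼ = suc j , λ { zero → y₀≤yⱼ ; (suc p) → max p }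
...   | inj₂ yⱼ≤y₀ = zero  , λ { zero → ℤP.≤-refl ; (suc p) → ℤP.≤-trans (max p) yⱼ≤y₀ }

module _ {n : ℕ} (G : Graph n) (y : Fin n → ℤ) (harmonic : ∀ j → ∑Δ G y j ≡ 0ℤ) where

  open ≡-Reasoning

  IsMaximum : Fin n → Set
  IsMaximum j = ∀ p → y p ℤ.≤ y j

  -- At a maximum j, the equation ∑Δ G y j = 0 is a vanishing sum of the nonnegative y j − y p, p ~ j.
  maximum-neighbour : ∀ {j p} → IsMaximum j → adj G j p ≡ true → y p ≡ y j
  maximum-neighbour {j} {p} max j~p = sym (ℤP.i-j≡0⇒i≡j (y j) (y p) (begin
    y j - y p
      ≡⟨ sym (ℤP.*-identityˡ (y j - y p)) ⟩
    1ℤ * (y j - y p)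
      ≡⟨ cong (λ b → (if b then 1ℤ else 0ℤ) * (y j - y p)) (sym j~p) ⟩
    adjℤ G j p * (y j - y p)
      ≡⟨ ∑-nonneg-≡0 _ nonneg (trans (∑Δ-neighbours G y j) (cong -_ (harmonic j))) p ⟩
    0ℤ ∎))
    where
    nonneg : ∀ q → 0ℤ ℤ.≤ adjℤ G j q * (y j - y q)
    nonneg q with adj G j q
    ... | true  = ℤP.≤-trans (ℤP.i≤j⇒0≤j-i (max q)) (ℤP.≤-reflexive (sym (ℤP.*-identityˡ _)))
    ... | false = ℤP.≤-refl

  maximum-along-walk : ∀ {i q} → Walk G i q → IsMaximum i → IsMaximum q
  maximum-along-walk here            max = max
  maximum-along-walk (step i~j walk) max =
    maximum-along-walk walk (λ p → ℤP.≤-trans (max p) (ℤP.≤-reflexive (sym (maximum-neighbour max i~j))))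

harmonic⇒constant : ∀ {n} (G : Graph n) → Connected G → (y : Fin n → ℤ) →
                    (∀ j → ∑Δ G y j ≡ 0ℤ) → ∀ p q → y p ≡ y q
harmonic⇒constant {suc n} G connected y harmonic p q with j , max ← ∃-maximum y =
  ℤP.≤-antisym (maximum-along-walk G y harmonic (connected j q) max p)
               (maximum-along-walk G y harmonic (connected j p) max q)

≗-lookup⇒≡ : ∀ {A : Set} {n} (xs ys : Vec A n) → (∀ i → lookup xs i ≡ lookup ys i) → xs ≡ ys
≗-lookup⇒≡ xs ys eq = begin
  xs                   ≡⟨ sym (VecP.tabulate∘lookup xs) ⟩
  tabulate (lookup xs) ≡⟨ VecP.tabulate-cong eq ⟩
  tabulate (lookup ys) ≡⟨ VecP.tabulate∘lookup ys ⟩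
  ys                   ∎
  where open ≡-Reasoning

-- a − b is constant, stated without subtraction.
DifferByConstant : ∀ {n} → Vec ℕ n → Vec ℕ n → Set
DifferByConstant a b = ∀ p q → lookup a p ℕ.+ lookup b q ≡ lookup a q ℕ.+ lookup b p

differByConstant-decreasing : ∀ {n} (a b : Vec ℕ n) → DifferByConstant a b → Decreasing a → Decreasing b
differByConstant-decreasing a b a∼b a↓ i j i≤j =
  ℕP.+-cancelˡ-≤ (lookup a i) _ _
    (ℕP.≤-trans (ℕP.≤-reflexive (a∼b i j)) (ℕP.+-monoˡ-≤ (lookup b i) (a↓ i j i≤j)))

module _ {n : ℕ} (G : Graph n) where

  open ≡-Reasoning

  lookup-T : ∀ i x j → lookup (T G i x) j ≡ lookup x j + lookup (Δ G i) j
  lookup-T i x j = VecP.lookup-zipWith _+_ j x (Δ G i)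

  lookup-iterT : ∀ k i x j → lookup (iter k (T G i) x) j ≡ lookup x j + + k * lookup (Δ G i) j
  lookup-iterT zero    i x j =
    sym (trans (cong (_+_ (lookup x j)) (ℤP.*-zeroˡ (lookup (Δ G i) j))) (ℤP.+-identityʳ _))
  lookup-iterT (suc k) i x j = begin
    lookup (T G i (iter k (T G i) x)) j
      ≡⟨ lookup-T i (iter k (T G i) x) j ⟩
    lookup (iter k (T G i) x) j + lookup (Δ G i) j
      ≡⟨ cong (_+ lookup (Δ G i) j) (lookup-iterT k i x j) ⟩
    lookup x j + + k * lookup (Δ G i) j + lookup (Δ G i) j
      ≡⟨ one-more (lookup x j) (+ k) (lookup (Δ G i) j) ⟩
    lookup x j + + suc k * lookup (Δ G i) j ∎
    where
    one-more : ∀ a k d → a + k * d + d ≡ a + (1ℤ + k) * d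
    one-more = solve-∀

  lookup-Tpow : ∀ a x j → lookup (Tpow G a x) j ≡ lookup x j + ∑Δ G (+_ ∘ lookup a) j
  lookup-Tpow a x j = lookup-fold id a
    where
    -- Tpow folds over the pairs (p , aₚ); the fold is analysed for an arbitrary labelling g.
    fold : ∀ {m} → Vec (Fin n × ℕ) m → Config n → Config n
    fold = Vec.foldr (λ _ → Config n → Config n) (λ p h y → iter (proj₂ p) (T G (proj₁ p)) (h y)) id
    lookup-fold : ∀ {m} (g : Fin m → Fin n) (b : Vec ℕ m) →
                  lookup (fold (Vec.zip (tabulate g) b) x) j
                  ≡ lookup x j + ∑[ p < m ] (+ lookup b p * lookup (Δ G (g p)) j)
    lookup-fold g []                = sym (ℤP.+-identityʳ _)
    lookup-fold {suc m} g (b₀ ∷ b) = begin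
      lookup (iter b₀ (T G (g zero)) rest) j  ≡⟨ lookup-iterT b₀ (g zero) rest j ⟩
      lookup rest j + t₀                      ≡⟨ cong (_+ t₀) (lookup-fold (g ∘ suc) b) ⟩
      lookup x j + ∑rest + t₀                 ≡⟨ rotate (lookup x j) ∑rest t₀ ⟩
      lookup x j + (t₀ + ∑rest)               ∎
      where
      rest : Config n
      rest = fold (Vec.zip (tabulate (g ∘ suc)) b) x
      t₀ ∑rest : ℤ
      t₀ = + b₀ * lookup (Δ G (g zero)) j
      ∑rest = ∑[ p < m ] (+ lookup b p * lookup (Δ G (g (suc p))) j)
      rotate : ∀ a b c → a + b + c ≡ a + (c + b)
      rotate = solve-∀

  Tpow-cong : ∀ a b x → (∀ j → ∑Δ G (+_ ∘ lookup a) j ≡ ∑Δ G (+_ ∘ lookup b) j) →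
              Tpow G a x ≡ Tpow G b x
  Tpow-cong a b x ∑Δ≡ = ≗-lookup⇒≡ _ _ λ j → begin
    lookup (Tpow G a x) j                ≡⟨ lookup-Tpow a x j ⟩
    lookup x j + ∑Δ G (+_ ∘ lookup a) j  ≡⟨ cong (_+_ (lookup x j)) (∑Δ≡ j) ⟩
    lookup x j + ∑Δ G (+_ ∘ lookup b) j  ≡⟨ lookup-Tpow b x j ⟨
    lookup (Tpow G b x) j                ∎

  Tpow-≡⇒∑Δ-≡ : ∀ a b x → Tpow G a x ≡ Tpow G b x →
                ∀ j → ∑Δ G (+_ ∘ lookup a) j ≡ ∑Δ G (+_ ∘ lookup b) j
  Tpow-≡⇒∑Δ-≡ a b x Tpowa≡Tpowb j = +-cancelˡ (lookup x j) _ _ (begin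
    lookup x j + ∑Δ G (+_ ∘ lookup a) j  ≡⟨ lookup-Tpow a x j ⟨
    lookup (Tpow G a x) j                ≡⟨ cong (λ v → lookup v j) Tpowa≡Tpowb ⟩
    lookup (Tpow G b x) j                ≡⟨ lookup-Tpow b x j ⟩
    lookup x j + ∑Δ G (+_ ∘ lookup b) j  ∎)

  Tpow-shift : ∀ a b c x → (∀ p → lookup a p ≡ lookup b p ℕ.+ c) → Tpow G a x ≡ Tpow G b x
  Tpow-shift a b c x a≡b+c = Tpow-cong a b x λ j → begin
    ∑Δ G (+_ ∘ lookup a) j
      ≡⟨ ∑Δ-cong G (λ p → trans (cong +_ (a≡b+c p)) (ℤP.pos-+ (lookup b p) c)) j ⟩
    ∑Δ G (λ p → + lookup b p + + c) j
      ≡⟨ ∑Δ-+ G (+_ ∘ lookup b) (λ _ → + c) j ⟩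
    ∑Δ G (+_ ∘ lookup b) j + ∑Δ G (λ _ → + c) j
      ≡⟨ cong (_+_ (∑Δ G (+_ ∘ lookup b) j)) (∑Δ-const G (+ c) j) ⟩
    ∑Δ G (+_ ∘ lookup b) j + 0ℤ
      ≡⟨ ℤP.+-identityʳ _ ⟩
    ∑Δ G (+_ ∘ lookup b) j ∎

  Tpow-injective : Connected G → ∀ a b x → Tpow G a x ≡ Tpow G b x → DifferByConstant a b
  Tpow-injective connected a b x Tpowa≡Tpowb p q = ℤP.+-injective (begin
    + (lookup a p ℕ.+ lookup b q)
      ≡⟨ ℤP.pos-+ (lookup a p) (lookup b q) ⟩
    + lookup a p + + lookup b q
      ≡⟨ i-j≡k-l⇒i+l≡k+j (+ lookup a p) (+ lookup b p) (+ lookup a q) (+ lookup b q) y-constant ⟩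
    + lookup a q + + lookup b p
      ≡⟨ ℤP.pos-+ (lookup a q) (lookup b p) ⟨
    + (lookup a q ℕ.+ lookup b p) ∎)
    where
    y : Fin n → ℤ
    y p = + lookup a p - + lookup b p
    harmonic : ∀ j → ∑Δ G y j ≡ 0ℤ
    harmonic j = trans (∑Δ-- G (+_ ∘ lookup a) (+_ ∘ lookup b) j)
                       (ℤP.i≡j⇒i-j≡0 (Tpow-≡⇒∑Δ-≡ a b x Tpowa≡Tpowb j))
    y-constant : y p ≡ y q
    y-constant = harmonic⇒constant G connected y harmonic p q

  dominated⇒decreasing : Connected G → ∀ c x → Tpow G c x ≤T[ G ] x → Decreasing c
  dominated⇒decreasing connected c x (b , b↓ , Tpowb≡Tpowc) =
    differByConstant-decreasing b c (Tpow-injective connected b c x Tpowb≡Tpowc) b↓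

-- Toppling sequences and Yamanouchi words

count : ∀ {n} → Fin n → ToppSeq n → ℕ
count r []      = 0
count r (i ∷ s) = if does (i ≟ r) then suc (count r s) else count r s

content : ∀ {n} → ToppSeq n → Vec ℕ n
content s = tabulate (λ r → count r s)

lookup-content : ∀ {n} (s : ToppSeq n) r → lookup (content s) r ≡ count r s
lookup-content s = VecP.lookup∘tabulate (λ r → count r s)

count-here : ∀ {n} (r : Fin n) s → count r (r ∷ s) ≡ suc (count r s)
count-here r s rewrite dec-true (r ≟ r) refl = refl

count-there : ∀ {n} {i r : Fin n} s → i ≢ r → count r (i ∷ s) ≡ count r s
count-there {i = i} {r} s i≢r rewrite dec-false (i ≟ r) i≢r = refl

Yamanouchi : ∀ {n} → ToppSeq n → Set
Yamanouchi s = ∀ m → Decreasing (content (take m s))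

module _ {n : ℕ} (G : Graph n) where

  open ≡-Reasoning

  ∑Δ-count-∷ : ∀ i s j →
               ∑Δ G (λ p → + count p (i ∷ s)) j ≡ lookup (Δ G i) j + ∑Δ G (λ p → + count p s) j
  ∑Δ-count-∷ i s j = begin
    ∑Δ G (λ p → + count p (i ∷ s)) j
      ≡⟨ ∑Δ-cong G split j ⟩
    ∑Δ G (λ p → indicator p + + count p s) j
      ≡⟨ ∑Δ-+ G indicator (λ p → + count p s) j ⟩
    ∑Δ G indicator j + ∑Δ G (λ p → + count p s) j
      ≡⟨ cong (_+ ∑Δ G (λ p → + count p s) j) (∑Δ-indicator G i j) ⟩
    lookup (Δ G i) j + ∑Δ G (λ p → + count p s) j ∎
    where
    indicator : Fin n → ℤ
    indicator p = if does (i ≟ p) then 1ℤ else 0ℤ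
    split : ∀ p → + count p (i ∷ s) ≡ indicator p + + count p s
    split p with i ≟ p
    ... | yes _ = refl
    ... | no  _ = refl

  lookup-run : ∀ s x j → lookup (run G s x) j ≡ lookup x j + ∑Δ G (λ p → + count p s) j
  lookup-run []      x j = sym (trans (cong (_+_ (lookup x j)) (∑Δ-const G 0ℤ j)) (ℤP.+-identityʳ _))
  lookup-run (i ∷ s) x j = begin
    lookup (run G s (T G i x)) j
      ≡⟨ lookup-run s (T G i x) j ⟩
    lookup (T G i x) j + ∑Δ G (λ p → + count p s) j
      ≡⟨ cong (_+ ∑Δ G (λ p → + count p s) j) (lookup-T G i x j) ⟩
    lookup x j + lookup (Δ G i) j + ∑Δ G (λ p → + count p s) j
      ≡⟨ ℤP.+-assoc (lookup x j) _ _ ⟩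
    lookup x j + (lookup (Δ G i) j + ∑Δ G (λ p → + count p s) j)
      ≡⟨ cong (_+_ (lookup x j)) (∑Δ-count-∷ i s j) ⟨
    lookup x j + ∑Δ G (λ p → + count p (i ∷ s)) j ∎

  run≡Tpow-content : ∀ s x → run G s x ≡ Tpow G (content s) x
  run≡Tpow-content s x = ≗-lookup⇒≡ _ _ λ j → begin
    lookup (run G s x) j
      ≡⟨ lookup-run s x j ⟩
    lookup x j + ∑Δ G (λ p → + count p s) j
      ≡⟨ cong (_+_ (lookup x j)) (∑Δ-cong G (cong +_ ∘ sym ∘ lookup-content s) j) ⟩
    lookup x j + ∑Δ G (+_ ∘ lookup (content s)) j
      ≡⟨ lookup-Tpow G (content s) x j ⟨
    lookup (Tpow G (content s) x) j ∎

  ≤T-refl : ∀ α → α ≤T[ G ] α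
  ≤T-refl α =
    content [] , (λ i j _ → ℕP.≤-reflexive (trans (lookup-content [] j) (sym (lookup-content [] i))))
               , sym (run≡Tpow-content [] α)

  allBelow⇒prefixes : ∀ {α γ} s → γ ≤T[ G ] α → AllBelow G α s γ →
                      ∀ m → run G (take m s) γ ≤T[ G ] α
  allBelow⇒prefixes []      γ≤α _                zero    = γ≤α
  allBelow⇒prefixes []      γ≤α _                (suc m) = γ≤α
  allBelow⇒prefixes (i ∷ s) γ≤α _                zero    = γ≤α
  allBelow⇒prefixes (i ∷ s) γ≤α (Tiγ≤α , below) (suc m) = allBelow⇒prefixes s Tiγ≤α below m

  prefixes⇒allBelow : ∀ {α γ} s → (∀ m → run G (take m s) γ ≤T[ G ] α) → AllBelow G α s γ
  prefixes⇒allBelow []      prefixes = tt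
  prefixes⇒allBelow (i ∷ s) prefixes = prefixes 1 , prefixes⇒allBelow s (prefixes ∘ suc)

  allBelow⇔yamanouchi : Connected G → ∀ α s → AllBelow G α s α ⇔ Yamanouchi s
  allBelow⇔yamanouchi connected α s = mk⇔
    (λ below m → dominated⇒decreasing G connected (content (take m s)) α
                   (subst (_≤T[ G ] α) (run≡Tpow-content (take m s) α)
                          (allBelow⇒prefixes s (≤T-refl α) below m)))
    (λ yamanouchi → prefixes⇒allBelow s λ m →
                   content (take m s) , yamanouchi m , sym (run≡Tpow-content (take m s) α))

count-take-suc-≡ : ∀ {n} (s : ToppSeq n) (m : Fin (length s)) {r} → List.lookup s m ≡ r →
                   count r (take (suc (toℕ m)) s) ≡ suc (count r (take (toℕ m) s))
count-take-suc-≡ (i ∷ s) zero    refl = count-here i []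
count-take-suc-≡ (i ∷ s) (suc m) refl with i ≟ List.lookup s m
... | yes _ = cong suc (count-take-suc-≡ s m refl)
... | no  _ = count-take-suc-≡ s m refl

count-take-suc-≢ : ∀ {n} (s : ToppSeq n) (m : Fin (length s)) {r} → List.lookup s m ≢ r →
                   count r (take (suc (toℕ m)) s) ≡ count r (take (toℕ m) s)
count-take-suc-≢ (i ∷ s) zero    i≢r = count-there [] i≢r
count-take-suc-≢ (i ∷ s) (suc m) {r} sₘ≢r with i ≟ r
... | yes _ = cong suc (count-take-suc-≢ s m sₘ≢r)
... | no  _ = count-take-suc-≢ s m sₘ≢r

count-take-mono : ∀ {n} (s : ToppSeq n) r {m m'} → m ≤ m' → count r (take m s) ≤ count r (take m' s)
count-take-mono s       r {zero}           _          = z≤n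
count-take-mono []      r {suc m} {suc m'} _          = z≤n
count-take-mono (i ∷ s) r {suc m} {suc m'} (s≤s m≤m') with i ≟ r
... | yes _ = s≤s (count-take-mono s r m≤m')
... | no  _ = count-take-mono s r m≤m'

count-take-≤ : ∀ {n} (s : ToppSeq n) r m → count r (take m s) ≤ count r s
count-take-≤ s       r zero    = z≤n
count-take-≤ []      r (suc m) = z≤n
count-take-≤ (i ∷ s) r (suc m) with i ≟ r
... | yes _ = s≤s (count-take-≤ s r m)
... | no  _ = count-take-≤ s r m

-- The (j+1)-th occurrence of r among the first L letters.
occurrence : ∀ {n} (s : ToppSeq n) r L j → j < count r (take L s) →
             ∃ λ (m : Fin (length s)) → toℕ m < L × List.lookup s m ≡ r × count r (take (toℕ m) s) ≡ j
occurrence []      r zero    j ()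
occurrence []      r (suc L) j ()
occurrence (i ∷ s) r zero    j ()
occurrence (i ∷ s) r (suc L) j j<count with i ≟ r
occurrence (i ∷ s) r (suc L) zero    _             | yes refl = zero , s≤s z≤n , refl , refl
occurrence (i ∷ s) r (suc L) (suc j) (s≤s j<count) | yes refl
  with m , m<L , sₘ≡i , countₘ≡j ← occurrence s i L j j<count
  = suc m , s≤s m<L , sₘ≡i , trans (count-here i (take (toℕ m) s)) (cong suc countₘ≡j)
occurrence (i ∷ s) r (suc L) j j<count | no i≢r
  with m , m<L , sₘ≡r , countₘ≡j ← occurrence s r L j j<count
  = suc m , s≤s m<L , sₘ≡r , trans (count-there (take (toℕ m) s) i≢r) countₘ≡j

adjacent-≢ : ∀ {n} {r r' : Fin n} → toℕ r' ≡ suc (toℕ r) → r' ≢ r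
adjacent-≢ r'≡1+r refl = ℕP.<-irrefl r'≡1+r (ℕP.n<1+n _)

-- Apply the Yamanouchi condition to the prefix ending at position m.
yamanouchi-count< : ∀ {n} (s : ToppSeq n) → Yamanouchi s → ∀ {r r'} → toℕ r' ≡ suc (toℕ r) →
                    ∀ m → List.lookup s m ≡ r' → count r' (take (toℕ m) s) < count r (take (toℕ m) s)
yamanouchi-count< s yamanouchi {r} {r'} r'≡1+r m sₘ≡r' = begin-strict
  count r' (take (toℕ m) s)
    <⟨ ℕP.n<1+n _ ⟩
  suc (count r' (take (toℕ m) s))
    ≡⟨ count-take-suc-≡ s m sₘ≡r' ⟨
  count r' (take (suc (toℕ m)) s)
    ≤⟨ subst₂ _≤_ (lookup-content (take (suc (toℕ m)) s) r') (lookup-content (take (suc (toℕ m)) s) r)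
                  (yamanouchi (suc (toℕ m)) r r' r≤r') ⟩
  count r (take (suc (toℕ m)) s)
    ≡⟨ count-take-suc-≢ s m (adjacent-≢ r'≡1+r ∘ trans (sym sₘ≡r')) ⟩
  count r (take (toℕ m) s) ∎
  where
  open ℕP.≤-Reasoning
  r≤r' : toℕ r ≤ toℕ r'
  r≤r' = ℕP.≤-trans (ℕP.n≤1+n _) (ℕP.≤-reflexive (sym r'≡1+r))

adjacent⇒decreasing : ∀ {n} (v : Vec ℕ n) →
                      (∀ r r' → toℕ r' ≡ suc (toℕ r) → lookup v r' ≤ lookup v r) → Decreasing v
adjacent⇒decreasing v            adjacent zero    zero    _ = ℕP.≤-refl
adjacent⇒decreasing (x ∷ y ∷ v) adjacent zero    (suc j) _ =
  ℕP.≤-trans (adjacent⇒decreasing (y ∷ v) (λ r r' → adjacent (suc r) (suc r') ∘ cong suc) zero j z≤n)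
             (adjacent zero (suc zero) refl)
adjacent⇒decreasing (x ∷ v)     adjacent (suc i) (suc j) (s≤s i≤j) =
  adjacent⇒decreasing v (λ r r' → adjacent (suc r) (suc r') ∘ cong suc) i j i≤j

‼⇒∈ : ∀ xs j {x} → xs ‼ j ≡ just x → x ∈ xs
‼⇒∈ (a ∷ xs) zero    refl  = here refl
‼⇒∈ (a ∷ xs) (suc j) entry = there (‼⇒∈ xs j entry)

∈⇒‼ : ∀ {x} xs → x ∈ xs → ∃ λ j → xs ‼ j ≡ just x
∈⇒‼ (a ∷ xs) (here refl)  = 0 , refl
∈⇒‼ (a ∷ xs) (there x∈xs) with j , entry ← ∈⇒‼ xs x∈xs = suc j , entry

‼-pred : ∀ xs j {y} → xs ‼ suc j ≡ just y → ∃ λ z → xs ‼ j ≡ just z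
‼-pred (a ∷ xs) zero    _     = a , refl
‼-pred (a ∷ xs) (suc j) entry = ‼-pred xs j entry

StrictlyIncreasing : List ℕ → Set
StrictlyIncreasing xs = ∀ j x y → xs ‼ j ≡ just x → xs ‼ suc j ≡ just y → x < y

increasing-head< : ∀ x xs → StrictlyIncreasing (x ∷ xs) → ∀ {y} → y ∈ xs → x < y
increasing-head< x xs increasing y∈xs with j , entry ← ∈⇒‼ xs y∈xs = below j entry
  where
  below : ∀ j {y} → xs ‼ j ≡ just y → x < y
  below zero    entry = increasing 0 x _ refl entry
  below (suc j) entry with z , previous ← ‼-pred xs j entry =
    ℕP.<-trans (below j previous) (increasing (suc j) z _ previous entry)

increasing-≡ : ∀ xs ys → StrictlyIncreasing xs → StrictlyIncreasing ys →
               (∀ {z} → z ∈ xs → z ∈ ys) → (∀ {z} → z ∈ ys → z ∈ xs) → xs ≡ ys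
increasing-≡ []       []       _   _   _     _     = refl
increasing-≡ []       (y ∷ ys) _   _   _     ys⊆xs with () ← ys⊆xs (here refl)
increasing-≡ (x ∷ xs) []       _   _   xs⊆ys _     with () ← xs⊆ys (here refl)
increasing-≡ (x ∷ xs) (y ∷ ys) xs↑ ys↑ xs⊆ys ys⊆xs =
  cong₂ _∷_ x≡y (increasing-≡ xs ys (xs↑ ∘ suc) (ys↑ ∘ suc) tail⊆ tail⊇)
  where
  x≡y : x ≡ y
  x≡y with xs⊆ys (here refl) | ys⊆xs (here refl)
  ... | here x≡y   | _          = x≡y
  ... | there _    | here y≡x   = sym y≡x
  ... | there x∈ys | there y∈xs =
    contradiction (increasing-head< y ys ys↑ x∈ys) (ℕP.<⇒≯ (increasing-head< x xs xs↑ y∈xs))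
  tail⊆ : ∀ {z} → z ∈ xs → z ∈ ys
  tail⊆ z∈xs with xs⊆ys (there z∈xs)
  ... | here refl  = contradiction x≡y (ℕP.<⇒≢ (increasing-head< x xs xs↑ z∈xs))
  ... | there z∈ys = z∈ys
  tail⊇ : ∀ {z} → z ∈ ys → z ∈ xs
  tail⊇ z∈ys with ys⊆xs (there z∈ys)
  ... | here refl  = contradiction (sym x≡y) (ℕP.<⇒≢ (increasing-head< y ys ys↑ z∈ys))
  ... | there z∈xs = z∈xs

unique-++ʳ : ∀ {xs ys : List ℕ} → Unique (xs List.++ ys) → Unique ys
unique-++ʳ {[]}     unique                = unique
unique-++ʳ {x ∷ xs} (_ AllPairs.∷ unique) = unique-++ʳ {xs} unique

unique-++-disjoint : ∀ {xs ys : List ℕ} {z} → Unique (xs List.++ ys) → z ∈ xs → z ∈ ys → ⊥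
unique-++-disjoint {x ∷ xs} (x∉ AllPairs.∷ _)     (here refl)  z∈ys =
  All.lookup x∉ (∈P.∈-++⁺ʳ xs z∈ys) refl
unique-++-disjoint {x ∷ xs} (_ AllPairs.∷ unique) (there z∈xs) z∈ys =
  unique-++-disjoint unique z∈xs z∈ys

∈-row⇒∈-concat : ∀ {n} {z} (rows : Vec (List ℕ) n) r →
                 z ∈ lookup rows r → z ∈ List.concat (Vec.toList rows)
∈-row⇒∈-concat (l ∷ rows) zero    z∈l   = ∈P.∈-++⁺ˡ z∈l
∈-row⇒∈-concat (l ∷ rows) (suc r) z∈row = ∈P.∈-++⁺ʳ l (∈-row⇒∈-concat rows r z∈row)

unique-concat-row : ∀ {n} {z} (rows : Vec (List ℕ) n) → Unique (List.concat (Vec.toList rows)) →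
                    ∀ r r' → z ∈ lookup rows r → z ∈ lookup rows r' → r ≡ r'
unique-concat-row (l ∷ rows) unique zero    zero     _   _    = refl
unique-concat-row (l ∷ rows) unique zero    (suc r') z∈l z∈r' =
  ⊥-elim (unique-++-disjoint unique z∈l (∈-row⇒∈-concat rows r' z∈r'))
unique-concat-row (l ∷ rows) unique (suc r) zero     z∈r z∈l  =
  ⊥-elim (unique-++-disjoint unique z∈l (∈-row⇒∈-concat rows r z∈r))
unique-concat-row (l ∷ rows) unique (suc r) (suc r') z∈r z∈r' =
  cong suc (unique-concat-row rows (unique-++ʳ {l} unique) r r' z∈r z∈r')

unique-↭-upTo : ∀ {xs} N → xs ↭ List.map ℕ.suc (List.upTo N) → Unique xs
unique-↭-upTo N xs↭ =
  ↭ₛP.Unique-resp-↭ (setoid ℕ) (↭⇒↭ₛ (↭-sym xs↭))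
                    (UniqueP.map⁺ ℕP.suc-injective (UniqueP.upTo⁺ N))

-- The tableau of a word

-- Row r of tableauFrom o s lists the numbers o + m + 1 for the positions m with sₘ = r.
tableauFrom : ∀ {n} → ℕ → ToppSeq n → Vec (List ℕ) n
tableauFrom o []      = Vec.replicate _ []
tableauFrom o (i ∷ s) = tableauFrom (suc o) s Vec.[ i ]%= (suc o ∷_)

tableau : ∀ {n} → ToppSeq n → Vec (List ℕ) n
tableau = tableauFrom 0

row-here : ∀ {n} o (s : ToppSeq n) i →
           lookup (tableauFrom o (i ∷ s)) i ≡ suc o ∷ lookup (tableauFrom (suc o) s) i
row-here o s i = VecP.lookup∘updateAt i (tableauFrom (suc o) s)

row-there : ∀ {n} o (s : ToppSeq n) {i r} → i ≢ r →
            lookup (tableauFrom o (i ∷ s)) r ≡ lookup (tableauFrom (suc o) s) r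
row-there o s {i} {r} i≢r = VecP.lookup∘updateAt′ r i (i≢r ∘ sym) (tableauFrom (suc o) s)

length-row : ∀ {n} o (s : ToppSeq n) r → length (lookup (tableauFrom o s) r) ≡ count r s
length-row o []      r = cong length (VecP.lookup-replicate r [])
length-row o (i ∷ s) r with i ≟ r
... | yes refl = trans (cong length (row-here o s i)) (cong suc (length-row (suc o) s i))
... | no  i≢r  = trans (cong length (row-there o s i≢r)) (length-row (suc o) s r)

row-∷-‼ : ∀ {n} o (s t : ToppSeq n) i r →
          lookup (tableauFrom o (i ∷ s)) r ‼ count r (i ∷ t) ≡ lookup (tableauFrom (suc o) s) r ‼ count r t
row-∷-‼ o s t i r with i ≟ r
... | yes refl = cong (_‼ suc (count i t)) (row-here o s i)
... | no  i≢r  = cong (_‼ count r t) (row-there o s i≢r)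

tableauFrom-entry : ∀ {n} o (s : ToppSeq n) (m : Fin (length s)) {r j} →
                    List.lookup s m ≡ r → count r (take (toℕ m) s) ≡ j →
                    lookup (tableauFrom o s) r ‼ j ≡ just (o ℕ.+ suc (toℕ m))
tableauFrom-entry o (i ∷ s) zero    refl refl = trans (cong (_‼ 0) (row-here o s i)) (cong just (ℕP.+-comm 1 o))
tableauFrom-entry o (i ∷ s) (suc m) refl refl =
  trans (row-∷-‼ o s (take (toℕ m) s) i (List.lookup s m))
        (trans (tableauFrom-entry (suc o) s m refl refl) (cong just (sym (ℕP.+-suc o (suc (toℕ m))))))

tableauFrom-entry⁻ : ∀ {n} o (s : ToppSeq n) r j x → lookup (tableauFrom o s) r ‼ j ≡ just x →
                     ∃ λ (m : Fin (length s)) →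
                       List.lookup s m ≡ r × count r (take (toℕ m) s) ≡ j × x ≡ o ℕ.+ suc (toℕ m)
tableauFrom-entry⁻ o [] r j x entry with () ← trans (cong (_‼ j) (sym (VecP.lookup-replicate r []))) entry
tableauFrom-entry⁻ o (i ∷ s) r j x entry with i ≟ r
... | no i≢r
  with m , sₘ≡r , countₘ≡j , x≡ ←
         tableauFrom-entry⁻ (suc o) s r j x (trans (cong (_‼ j) (sym (row-there o s i≢r))) entry)
  = suc m , sₘ≡r , trans (count-there (take (toℕ m) s) i≢r) countₘ≡j
  , trans x≡ (sym (ℕP.+-suc o (suc (toℕ m))))
... | yes refl with j | trans (cong (_‼ j) (sym (row-here o s i))) entry
...   | zero  | refl = zero , refl , refl , ℕP.+-comm 1 o
...   | suc j | entry′
  with m , sₘ≡i , countₘ≡j , x≡ ← tableauFrom-entry⁻ (suc o) s i j x entry′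
  = suc m , sₘ≡i , trans (count-here i (take (toℕ m) s)) (cong suc countₘ≡j)
  , trans x≡ (sym (ℕP.+-suc o (suc (toℕ m))))

ColumnStrict : ∀ {n} → Vec (List ℕ) n → Set
ColumnStrict {n} rows = ∀ (r r' : Fin n) → toℕ r' ≡ suc (toℕ r) →
                        ∀ j y → lookup rows r' ‼ j ≡ just y →
                        ∃ λ x → lookup rows r ‼ j ≡ just x × x < y

row-increasing : ∀ {n} o (s : ToppSeq n) r → StrictlyIncreasing (lookup (tableauFrom o s) r)
row-increasing o s r j x y xEntry yEntry
  with m₁ , _ , count₁ , refl ← tableauFrom-entry⁻ o s r j x xEntry
     | m₂ , _ , count₂ , refl ← tableauFrom-entry⁻ o s r (suc j) y yEntry
  = ℕP.+-monoʳ-< o (s≤s (ℕP.≰⇒> m₂≰m₁))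
  where
  m₂≰m₁ : ¬ toℕ m₂ ≤ toℕ m₁
  m₂≰m₁ m₂≤m₁ = ℕP.1+n≰n (subst₂ _≤_ count₂ count₁ (count-take-mono s r m₂≤m₁))

yamanouchi⇒columnStrict : ∀ {n} (s : ToppSeq n) → Yamanouchi s → ColumnStrict (tableau s)
yamanouchi⇒columnStrict s yamanouchi r r' r'≡1+r j y yEntry
  with m , sₘ≡r' , countₘ≡j , refl ← tableauFrom-entry⁻ 0 s r' j y yEntry
  with m₀ , m₀<m , sₘ₀≡r , countₘ₀≡j ←
         occurrence s r (toℕ m) j (subst (_< _) countₘ≡j (yamanouchi-count< s yamanouchi r'≡1+r m sₘ≡r'))
  = suc (toℕ m₀) , tableauFrom-entry 0 s m₀ sₘ₀≡r countₘ₀≡j , s≤s m₀<m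

columnStrict⇒yamanouchi : ∀ {n} (s : ToppSeq n) → ColumnStrict (tableau s) → Yamanouchi s
columnStrict⇒yamanouchi s column L = adjacent⇒decreasing (content (take L s)) λ r r' r'≡1+r →
  subst₂ _≤_ (sym (lookup-content (take L s) r')) (sym (lookup-content (take L s) r)) (adjacent r r' r'≡1+r)
  where
  adjacent : ∀ r r' → toℕ r' ≡ suc (toℕ r) → count r' (take L s) ≤ count r (take L s)
  adjacent r r' r'≡1+r with count r' (take L s) in count≡
  ... | zero  = z≤n
  ... | suc j
    with m , m<L , sₘ≡r' , countₘ≡j ← occurrence s r' L j (ℕP.≤-reflexive (sym count≡))
    with x , xEntry , x<1+m ←
           column r r' r'≡1+r j (suc (toℕ m)) (tableauFrom-entry 0 s m sₘ≡r' countₘ≡j)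
    with m₀ , sₘ₀≡r , countₘ₀≡j , refl ← tableauFrom-entry⁻ 0 s r j x xEntry
    = subst (_≤ count r (take L s)) (trans (count-take-suc-≡ s m₀ sₘ₀≡r) (cong suc countₘ₀≡j))
        (count-take-mono s r (ℕP.≤-trans (ℕ.s≤s⁻¹ x<1+m) (ℕP.<⇒≤ m<L)))

concat-updateAt-∷ : ∀ {n} (v : Vec (List ℕ) n) i x →
                    List.concat (Vec.toList (v Vec.[ i ]%= (x ∷_))) ↭ x ∷ List.concat (Vec.toList v)
concat-updateAt-∷ (l ∷ v) zero    x = ↭-refl
concat-updateAt-∷ (l ∷ v) (suc i) x = ↭-trans (↭P.++⁺ˡ l (concat-updateAt-∷ v i x)) (↭P.shift x l _)

concat-replicate-[] : ∀ n → List.concat (Vec.toList (Vec.replicate n (List.[] {A = ℕ}))) ≡ []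
concat-replicate-[] zero    = refl
concat-replicate-[] (suc n) = concat-replicate-[] n

applyUpTo-cong : ∀ {A : Set} {f g : ℕ → A} → (∀ m → f m ≡ g m) →
                 ∀ N → List.applyUpTo f N ≡ List.applyUpTo g N
applyUpTo-cong f≗g zero    = refl
applyUpTo-cong f≗g (suc N) = cong₂ _∷_ (f≗g 0) (applyUpTo-cong (f≗g ∘ suc) N)

concat-tableauFrom : ∀ {n} o (s : ToppSeq n) →
                     List.concat (Vec.toList (tableauFrom o s)) ↭ List.applyUpTo (λ m → o ℕ.+ suc m) (length s)
concat-tableauFrom {n} o [] = ↭-reflexive (concat-replicate-[] n)
concat-tableauFrom o (i ∷ s) =
  ↭-trans (concat-updateAt-∷ (tableauFrom (suc o) s) i (suc o))
    (↭-trans (↭-prep (suc o) (concat-tableauFrom (suc o) s))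
      (↭-reflexive (cong₂ _∷_ (ℕP.+-comm 1 o) (applyUpTo-cong (λ m → sym (ℕP.+-suc o (suc m))) (length s)))))

content-∷ : ∀ {n} (i : Fin n) s → content (i ∷ s) ≡ content s Vec.[ i ]%= suc
content-∷ i s = ≗-lookup⇒≡ _ _ λ r → trans (lookup-content (i ∷ s) r) (bump r)
  where
  bump : ∀ r → count r (i ∷ s) ≡ lookup (content s Vec.[ i ]%= suc) r
  bump r with i ≟ r
  ... | yes refl = sym (trans (VecP.lookup∘updateAt i (content s)) (cong suc (lookup-content s i)))
  ... | no  i≢r  = sym (trans (VecP.lookup∘updateAt′ r i (i≢r ∘ sym) (content s)) (lookup-content s r))

sum-updateAt-suc : ∀ {n} (v : Vec ℕ n) i → Vec.sum (v Vec.[ i ]%= suc) ≡ suc (Vec.sum v)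
sum-updateAt-suc (x ∷ v) zero    = refl
sum-updateAt-suc (x ∷ v) (suc i) = trans (cong (x ℕ.+_) (sum-updateAt-suc v i)) (ℕP.+-suc x _)

sum-content : ∀ {n} (s : ToppSeq n) → Vec.sum (content s) ≡ length s
sum-content {zero}  []      = refl
sum-content {suc n} []      = sum-content {n} []
sum-content         (i ∷ s) =
  trans (cong Vec.sum (content-∷ i s)) (trans (sum-updateAt-suc (content s) i) (cong suc (sum-content s)))

map-length-tableau : ∀ {n} (s : ToppSeq n) → Vec.map length (tableau s) ≡ content s
map-length-tableau s = ≗-lookup⇒≡ _ _ λ r →
  trans (VecP.lookup-map r length (tableau s)) (trans (length-row 0 s r) (sym (lookup-content s r)))

yamanouchi⇒SYT : ∀ {n} (s : ToppSeq n) → Yamanouchi s →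
                 IsSYT (content s) (tableau s) × AssocSeq (tableau s) s
yamanouchi⇒SYT s yamanouchi =
  ( (λ r → trans (length-row 0 s r) (sym (lookup-content s r)))
  , row-increasing 0 s
  , yamanouchi⇒columnStrict s yamanouchi
  , ↭-trans (concat-tableauFrom 0 s) (↭-reflexive (sym upTo-content)) )
  , ( sym (trans (cong Vec.sum (map-length-tableau s)) (sum-content s))
    , λ m → ‼⇒∈ _ _ (tableauFrom-entry 0 s m refl refl) )
  where
  upTo-content : List.map ℕ.suc (List.upTo (Vec.sum (content s))) ≡ List.applyUpTo ℕ.suc (length s)
  upTo-content = trans (cong (List.map ℕ.suc ∘ List.upTo) (sum-content s))
                       (ListP.map-applyUpTo id ℕ.suc (length s))

-- Distinct entries and strictly increasing rows force rows to be the tableau of s.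
SYT⇒yamanouchi : ∀ {n} (lam : Vec ℕ n) rows s → IsSYT lam rows → AssocSeq rows s →
                 content s ≡ lam × Yamanouchi s
SYT⇒yamanouchi lam rows s (row-lengths , increasing , column , rows↭) (length≡ , associated) =
  content≡lam , columnStrict⇒yamanouchi s (subst ColumnStrict rows≡tableau column)
  where
  length-s : length s ≡ Vec.sum lam
  length-s = trans length≡ (cong Vec.sum (≗-lookup⇒≡ (Vec.map length rows) lam λ r →
               trans (VecP.lookup-map r length rows) (row-lengths r)))
  row⊆tableau : ∀ r {z} → z ∈ lookup rows r → z ∈ lookup (tableau s) r
  row⊆tableau r z∈row
    with k , k∈upTo , refl ←
           ∈P.∈-map⁻ ℕ.suc (↭P.∈-resp-↭ rows↭ (∈-row⇒∈-concat rows r z∈row))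
    with k<length ← subst (k <_) (sym length-s) (∈P.∈-upTo⁻ k∈upTo)
    with m ← Fin.fromℕ< k<length | toℕ-m ← FinP.toℕ-fromℕ< k<length
    = subst (λ i → suc i ∈ lookup (tableau s) r) toℕ-m (‼⇒∈ _ _ (tableauFrom-entry 0 s m sₘ≡r refl))
    where
    sₘ≡r : List.lookup s m ≡ r
    sₘ≡r = unique-concat-row rows (unique-↭-upTo (Vec.sum lam) rows↭) (List.lookup s m) r
             (subst (λ i → suc i ∈ lookup rows (List.lookup s m)) toℕ-m (associated m)) z∈row
  tableau⊆row : ∀ r {z} → z ∈ lookup (tableau s) r → z ∈ lookup rows r
  tableau⊆row r z∈tableau
    with j , entry ← ∈⇒‼ _ z∈tableau
    with m , refl , _ , refl ← tableauFrom-entry⁻ 0 s r j _ entry = associated m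
  rows≡tableau : rows ≡ tableau s
  rows≡tableau = ≗-lookup⇒≡ _ _ λ r →
    increasing-≡ _ _ (increasing r) (row-increasing 0 s r) (row⊆tableau r) (tableau⊆row r)
  content≡lam : content s ≡ lam
  content≡lam = ≗-lookup⇒≡ _ _ λ r → begin
    lookup (content s) r           ≡⟨ lookup-content s r ⟩
    count r s                      ≡⟨ length-row 0 s r ⟨
    length (lookup (tableau s) r)  ≡⟨ cong (λ v → length (lookup v r)) rows≡tableau ⟨
    length (lookup rows r)         ≡⟨ row-lengths r ⟩
    lookup lam r                   ∎
    where open ≡-Reasoning

-- 0^λ₁ 1^λ₂ 2^λ₃ ⋯, the word of the tableau whose rows are filled consecutively.
yamanouchiWord : ∀ {n} → Vec ℕ n → ToppSeq n
yamanouchiWord []          = []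
yamanouchiWord (l ∷ lam) = List.replicate l zero List.++ List.map suc (yamanouchiWord lam)

count-zero-map-suc : ∀ {n} (w : ToppSeq n) → count zero (List.map suc w) ≡ 0
count-zero-map-suc []      = refl
count-zero-map-suc (i ∷ w) = count-zero-map-suc w

count-suc-map-suc : ∀ {n} (r : Fin n) w → count (suc r) (List.map suc w) ≡ count r w
count-suc-map-suc r []      = refl
count-suc-map-suc r (i ∷ w) with i ≟ r
... | yes _ = cong suc (count-suc-map-suc r w)
... | no  _ = count-suc-map-suc r w

module _ {n : ℕ} (w : ToppSeq n) where

  count-zero-++ : ∀ l → count zero (List.replicate l zero List.++ List.map suc w) ≡ l
  count-zero-++ zero    = count-zero-map-suc w
  count-zero-++ (suc l) = cong suc (count-zero-++ l)

  count-suc-++ : ∀ r l → count (suc r) (List.replicate l zero List.++ List.map suc w) ≡ count r w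
  count-suc-++ r zero    = count-suc-map-suc r w
  count-suc-++ r (suc l) = count-suc-++ r l

  count-zero-take-++ : ∀ l m → count zero (take m (List.replicate l zero List.++ List.map suc w)) ≡ m ℕ.⊓ l
  count-zero-take-++ zero    m       =
    trans (cong (count zero) (ListP.take-map m w)) (trans (count-zero-map-suc (take m w)) (sym (ℕP.⊓-zeroʳ m)))
  count-zero-take-++ (suc l) zero    = refl
  count-zero-take-++ (suc l) (suc m) = cong suc (count-zero-take-++ l m)

  count-suc-take-++ : ∀ r l m → count (suc r) (take m (List.replicate l zero List.++ List.map suc w))
                                ≡ count r (take (m ∸ l) w)
  count-suc-take-++ r zero    m       =
    trans (cong (count (suc r)) (ListP.take-map m w)) (count-suc-map-suc r (take m w))
  count-suc-take-++ r (suc l) zero    = refl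
  count-suc-take-++ r (suc l) (suc m) = count-suc-take-++ r l m

count-yamanouchiWord : ∀ {n} (lam : Vec ℕ n) r → count r (yamanouchiWord lam) ≡ lookup lam r
count-yamanouchiWord (l ∷ lam) zero    = count-zero-++ (yamanouchiWord lam) l
count-yamanouchiWord (l ∷ lam) (suc r) =
  trans (count-suc-++ (yamanouchiWord lam) r l) (count-yamanouchiWord lam r)

content-yamanouchiWord : ∀ {n} (lam : Vec ℕ n) → content (yamanouchiWord lam) ≡ lam
content-yamanouchiWord lam = ≗-lookup⇒≡ _ _ λ r →
  trans (lookup-content (yamanouchiWord lam) r) (count-yamanouchiWord lam r)

yamanouchiWord-prefix : ∀ {n} (lam : Vec ℕ n) → Decreasing lam →
                        ∀ m (i j : Fin n) → toℕ i ≤ toℕ j →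
                        count j (take m (yamanouchiWord lam)) ≤ count i (take m (yamanouchiWord lam))
yamanouchiWord-prefix (l ∷ lam) lam↓ m zero zero _ = ℕP.≤-refl
yamanouchiWord-prefix (l ∷ lam) lam↓ m zero (suc j) _ =
  subst₂ _≤_ (sym (count-suc-take-++ w j l m)) (sym (count-zero-take-++ w l m)) (bounded (ℕP.≤-total m l))
  where
  w : ToppSeq _
  w = yamanouchiWord lam
  bounded : m ≤ l ⊎ l ≤ m → count j (take (m ∸ l) w) ≤ m ℕ.⊓ l
  bounded (inj₁ m≤l) rewrite ℕP.m≤n⇒m∸n≡0 m≤l = z≤n
  bounded (inj₂ l≤m) rewrite ℕP.m≥n⇒m⊓n≡n l≤m =
    ℕP.≤-trans (count-take-≤ w j (m ∸ l))
               (subst (_≤ l) (sym (count-yamanouchiWord lam j)) (lam↓ zero (suc j) z≤n))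
yamanouchiWord-prefix (l ∷ lam) lam↓ m (suc i) (suc j) (s≤s i≤j) =
  subst₂ _≤_ (sym (count-suc-take-++ w j l m)) (sym (count-suc-take-++ w i l m))
    (yamanouchiWord-prefix lam (λ i j → lam↓ (suc i) (suc j) ∘ s≤s) (m ∸ l) i j i≤j)
  where
  w : ToppSeq _
  w = yamanouchiWord lam

yamanouchiWord-yamanouchi : ∀ {n} (lam : Vec ℕ n) → Decreasing lam → Yamanouchi (yamanouchiWord lam)
yamanouchiWord-yamanouchi lam lam↓ m i j i≤j =
  subst₂ _≤_ (sym (lookup-content (take m (yamanouchiWord lam)) j))
             (sym (lookup-content (take m (yamanouchiWord lam)) i))
             (yamanouchiWord-prefix lam lam↓ m i j i≤j)

-- Partitions and minimal toppling sequences

sum-mono : ∀ {n} (u v : Vec ℕ n) → (∀ p → lookup u p ≤ lookup v p) → Vec.sum u ≤ Vec.sum v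
sum-mono []       []       _   = z≤n
sum-mono (x ∷ u) (y ∷ v) u≤v = ℕP.+-mono-≤ (u≤v zero) (sum-mono u v (u≤v ∘ suc))

pointwise-≤-sum-≥⇒≡ : ∀ {n} (u v : Vec ℕ n) → (∀ p → lookup u p ≤ lookup v p) →
                      Vec.sum v ≤ Vec.sum u → u ≡ v
pointwise-≤-sum-≥⇒≡ []       []       _   _ = refl
pointwise-≤-sum-≥⇒≡ (x ∷ u) (y ∷ v) u≤v v≤u with ℕP.m≤n⇒m<n∨m≡n (u≤v zero)
... | inj₂ refl = cong (x ∷_) (pointwise-≤-sum-≥⇒≡ u v (u≤v ∘ suc) (ℕP.+-cancelˡ-≤ x _ _ v≤u))
... | inj₁ x<y  = contradiction v≤u (ℕP.<⇒≱ (ℕP.+-mono-<-≤ x<y (sum-mono u v (u≤v ∘ suc))))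

module _ {k : ℕ} (G : Graph (suc k)) (α : Config (suc k)) where

  last : Fin (suc k)
  last = fromℕ k

  -- Subtracting the last (smallest) multiplicity does not change T^a(α), since Σₚ Δₚ = 0.
  dominance⇒partition : ∀ {β} → β ≤T[ G ] α →
                        Σ (Vec ℕ (suc k)) λ lam → InP lam × Tpow G lam α ≡ β
  dominance⇒partition (a , a↓ , Tpowa≡β) =
    lam , (lam↓ , lam-last) , trans (sym (Tpow-shift G a lam (lookup a last) α a≡lam+aₙ)) Tpowa≡β
    where
    lam : Vec ℕ (suc k)
    lam = tabulate (λ p → lookup a p ∸ lookup a last)
    lookup-lam : ∀ p → lookup lam p ≡ lookup a p ∸ lookup a last
    lookup-lam = VecP.lookup∘tabulate (λ p → lookup a p ∸ lookup a last)
    lam↓ : Decreasing lam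
    lam↓ i j i≤j = subst₂ _≤_ (sym (lookup-lam j)) (sym (lookup-lam i))
                              (ℕP.∸-monoˡ-≤ (lookup a last) (a↓ i j i≤j))
    lam-last : lookup lam last ≡ 0
    lam-last = trans (lookup-lam last) (ℕP.n∸n≡0 (lookup a last))
    aₙ≤aₚ : ∀ p → lookup a last ≤ lookup a p
    aₙ≤aₚ p = a↓ p last (subst (toℕ p ≤_) (sym (FinP.toℕ-fromℕ k)) (FinP.toℕ≤pred[n] p))
    a≡lam+aₙ : ∀ p → lookup a p ≡ lookup lam p ℕ.+ lookup a last
    a≡lam+aₙ p = sym (trans (cong (ℕ._+ lookup a last) (lookup-lam p)) (ℕP.m∸n+n≡m (aₙ≤aₚ p)))

  partition-≤ : Connected G → ∀ lam c → InP lam → Tpow G c α ≡ Tpow G lam α →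
                ∀ p → lookup lam p ≤ lookup c p
  partition-≤ connected lam c (_ , lam-last) Tpowc≡Tpowlam p =
    subst (lookup lam p ≤_) cₚ≡ (ℕP.m≤n+m _ _)
    where
    cₚ≡ : lookup c last ℕ.+ lookup lam p ≡ lookup c p
    cₚ≡ = sym (begin
      lookup c p                      ≡⟨ ℕP.+-identityʳ (lookup c p) ⟨
      lookup c p ℕ.+ 0                ≡⟨ cong (lookup c p ℕ.+_) lam-last ⟨
      lookup c p ℕ.+ lookup lam last  ≡⟨ Tpow-injective G connected c lam α Tpowc≡Tpowlam p last ⟩
      lookup c last ℕ.+ lookup lam p  ∎)
      where open ≡-Reasoning

  partition-unique : Connected G → ∀ mu lam → InP mu → InP lam →
                     Tpow G mu α ≡ Tpow G lam α → mu ≡ lam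
  partition-unique connected mu lam mu∈P lam∈P Tpowmu≡Tpowlam = ≗-lookup⇒≡ _ _ λ p →
    ℕP.≤-antisym (partition-≤ connected mu lam mu∈P (sym Tpowmu≡Tpowlam) p)
                 (partition-≤ connected lam mu lam∈P Tpowmu≡Tpowlam p)

  module _ (connected : Connected G) (lam : Vec ℕ (suc k)) (lam∈P : InP lam)
           {β} (Tpowlam≡β : Tpow G lam α ≡ β) where

    run≡β⇒lam≤content : ∀ s → run G s α ≡ β → ∀ p → lookup lam p ≤ lookup (content s) p
    run≡β⇒lam≤content s run≡β =
      partition-≤ connected lam (content s) lam∈P
        (trans (sym (run≡Tpow-content G s α)) (trans run≡β (sym Tpowlam≡β)))

    run≡β⇒|lam|≤length : ∀ s → run G s α ≡ β → Vec.sum lam ≤ length s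
    run≡β⇒|lam|≤length s run≡β =
      subst (Vec.sum lam ≤_) (sum-content s) (sum-mono lam (content s) (run≡β⇒lam≤content s run≡β))

    content≡lam⇒run≡β : ∀ s → content s ≡ lam → run G s α ≡ β
    content≡lam⇒run≡β s content≡lam =
      trans (run≡Tpow-content G s α) (trans (cong (λ c → Tpow G c α) content≡lam) Tpowlam≡β)

    minimal⇒SYT : ∀ s → MinInY G α β s → ∃ λ rows → IsSYT lam rows × AssocSeq rows s
    minimal⇒SYT s ((run≡β , below) , minimal) =
      tableau s , subst (λ c → IsSYT c (tableau s)) content≡lam (proj₁ tableau-SYT) , proj₂ tableau-SYT
      where
      yamanouchi : Yamanouchi s
      yamanouchi = Equivalence.to (allBelow⇔yamanouchi G connected α s) below
      tableau-SYT : IsSYT (content s) (tableau s) × AssocSeq (tableau s) s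
      tableau-SYT = yamanouchi⇒SYT s yamanouchi
      word : ToppSeq (suc k)
      word = yamanouchiWord lam
      word∈Y : InY G α β word
      word∈Y = content≡lam⇒run≡β word (content-yamanouchiWord lam)
             , Equivalence.from (allBelow⇔yamanouchi G connected α word)
                                  (yamanouchiWord-yamanouchi lam (proj₁ lam∈P))
      |content|≤|lam| : Vec.sum (content s) ≤ Vec.sum lam
      |content|≤|lam| =
        subst₂ _≤_ (sym (sum-content s))
                   (trans (sym (sum-content word)) (cong Vec.sum (content-yamanouchiWord lam)))
                   (minimal word word∈Y)
      content≡lam : content s ≡ lam
      content≡lam =
        sym (pointwise-≤-sum-≥⇒≡ lam (content s) (run≡β⇒lam≤content s run≡β) |content|≤|lam|)

    SYT⇒minimal : ∀ s → (∃ λ rows → IsSYT lam rows × AssocSeq rows s) → MinInY G α β s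
    SYT⇒minimal s (rows , syt , associated)
      with content≡lam , yamanouchi ← SYT⇒yamanouchi lam rows s syt associated =
        ( content≡lam⇒run≡β s content≡lam
        , Equivalence.from (allBelow⇔yamanouchi G connected α s) yamanouchi )
      , λ s' (run≡β , _) → subst (_≤ length s') (trans (cong Vec.sum (sym content≡lam)) (sum-content s))
                                 (run≡β⇒|lam|≤length s' run≡β)

mainTheorem3 : ∀ (k : ℕ) (G : Graph (suc k)) → Connected G →
  ∀ (α β : Config (suc k)) → β ≤T[ G ] α →
  Σ (Vec ℕ (suc k)) λ lam →
      InP lam × Tpow G lam α ≡ β
    × (∀ (mu : Vec ℕ (suc k)) → InP mu → Tpow G mu α ≡ β → mu ≡ lam)
    × (∀ (s : ToppSeq (suc k)) →
         MinInY G α β s ⇔ (∃ λ (rows : Vec (List ℕ) (suc k)) → IsSYT lam rows × AssocSeq rows s))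
mainTheorem3 k G connected α β β≤α with lam , lam∈P , Tpowlam≡β ← dominance⇒partition G α β≤α =
  lam , lam∈P , Tpowlam≡β
  , (λ mu mu∈P Tpowmu≡β →
       partition-unique G α connected mu lam mu∈P lam∈P (trans Tpowmu≡β (sym Tpowlam≡β)))
  , (λ s → mk⇔ (minimal⇒SYT G α connected lam lam∈P Tpowlam≡β s)
               (SYT⇒minimal G α connected lam lam∈P Tpowlam≡β s))
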